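{- For every $n\ge1$, $x_n^{(4)}=2n+3$ if $n\cdot\nu_2(n+1)$ is even, and $x_n^{(4)}=2n+2$ otherwise.
   Context: $t(m)\in\{0,1\}$ is the parity of the number of ones in the binary expansion of $m$. Define $x_1^{(4)}=4$ and, for $n\ge2$, $x_n^{(4)}$ is the smallest integer $y>x_{n-1}^{(4)}$ with $t(y)=t(n)$. $\nu_2(m)$ is the exponent of the highest power of $2$ dividing the positive integer $m$. -}

module Defs where

open import Data.Nat using (ℕ; zero; suc; _+_; _*_; _^_; _<_; _≤_; ⌊_/2⌋)
open import Data.Nat.Divisibility using (_∣_)
open import Data.Bool using (Bool; true; false; not; _xor_)
open import Relation.Binary.PropositionalEquality using (_≡_)
open import Relation.Nullary using (¬_)

-- parity of the number of ones in the binary expansion, computed with fuel;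
-- fuel m is always enough for m (m halves at each step)
tFuel : ℕ → ℕ → Bool
tFuel zero    m = false
tFuel (suc k) zero = false
tFuel (suc k) (suc m) = Data.Nat._≡ᵇ_ ((suc m) Data.Nat.% 2) 1 xor tFuel k ⌊ suc m /2⌋

-- t(m) ∈ {0,1} encoded as Bool (true = odd number of ones)
t : ℕ → Bool
t m = tFuel m m

IsNu2 : ℕ → ℕ → Set
IsNu2 m k = (2 ^ k ∣ m) × ¬ (2 ^ suc k ∣ m)
  where open import Data.Product using (_×_)

-- x is the sequence x^(4) (indexed from 1; x 0 is irrelevant):
-- x 1 = 4, and for n ≥ 2, x n is the least y > x (n-1) with t y = t n
IsX4 : (ℕ → ℕ) → Set
IsX4 x = (x 1 ≡ 4) × ((n : ℕ) → 2 ≤ n →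
           (x (Data.Nat.pred n) < x n) × (t (x n) ≡ t n) ×
           ((y : ℕ) → x (Data.Nat.pred n) < y → y < x n → ¬ (t y ≡ t n)))
  where open import Data.Product using (_×_)

Even : ℕ → Set
Even m = 2 ∣ m

-- Since t(2m) = t(m) and t(2m+1) = ¬ t(m), the search for x n starts above
-- x (n-1) ∈ {2n, 2n+1}: it rejects 2n+1, stops at 2n+2 when t(n+1) = t(n), and
-- otherwise at 2n+3, whose t-value ¬ t(n+1) is then t(n). Writing
-- n+1 = 2^k (2j+1) gives t(n+1) = ¬ t(j), while t(n) = t(j) for even k (because
-- t(4b+3) = t(b)) and t(n) = ¬ t(j) for odd k. Finally n·k is even exactly when
-- k is, as k ≥ 1 forces n to be odd.
module Submission where

open import Defs
open import Data.Nat
open import Data.Nat.Properties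
open import Data.Nat.DivMod using (m*n%n≡0; [m+kn]%n≡m%n)
open import Data.Nat.Divisibility using (_∣_; divides; ∣-trans; m∣m*n; ∣n⇒∣m*n; ∣m+n∣m⇒∣n; ∣1⇒≡1)
open import Data.Nat.Primality using (Prime; prime?; euclidsLemma)
open import Data.Bool using (Bool; true; false; not; _xor_)
open import Data.Bool.Properties using (not-involutive; not-¬; ¬-not) renaming (_≟_ to _≟ᵇ_)
open import Data.Product using (_×_; _,_; proj₁; proj₂; ∃-syntax)
open import Data.Sum using (_⊎_; inj₁; inj₂; [_,_]′)
open import Data.Empty using (⊥-elim)
open import Function using (_∘_)
open import Relation.Binary.PropositionalEquality
open import Relation.Nullary using (¬_; Dec; yes; no; contradiction)
open import Relation.Nullary.Decidable using (from-yes)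

tFuel-zero : ∀ f → tFuel f 0 ≡ false
tFuel-zero zero    = refl
tFuel-zero (suc f) = refl

tFuel-irrelevant : ∀ {f g} m → m ≤ f → m ≤ g → tFuel f m ≡ tFuel g m
tFuel-irrelevant {f} {g} zero _ _ = trans (tFuel-zero f) (sym (tFuel-zero g))
tFuel-irrelevant (suc m) (s≤s m≤f) (s≤s m≤g) =
  cong (((suc m % 2) ≡ᵇ 1) xor_) (tFuel-irrelevant ⌊ suc m /2⌋ (≤-trans h≤m m≤f) (≤-trans h≤m m≤g))
  where
  h≤m : ⌊ suc m /2⌋ ≤ m
  h≤m = ≤-pred (⌊n/2⌋<n m)

t-unfold : ∀ m → t m ≡ ((m % 2) ≡ᵇ 1) xor t ⌊ m /2⌋
t-unfold zero    = refl
t-unfold (suc m) = cong (((suc m % 2) ≡ᵇ 1) xor_) (tFuel-irrelevant ⌊ suc m /2⌋ (≤-pred (⌊n/2⌋<n m)) ≤-refl)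

2*m≡m+m : ∀ m → 2 * m ≡ m + m
2*m≡m+m m = cong (m +_) (+-identityʳ m)

⌊1+m+m/2⌋≡m : ∀ m → ⌊ suc (m + m) /2⌋ ≡ m
⌊1+m+m/2⌋≡m zero    = refl
⌊1+m+m/2⌋≡m (suc m) = cong suc (trans (cong ⌊_/2⌋ (+-suc m m)) (⌊1+m+m/2⌋≡m m))

t-double : ∀ m → t (2 * m) ≡ t m
t-double m = begin
  t (2 * m)                                     ≡⟨ t-unfold (2 * m) ⟩
  ((2 * m % 2) ≡ᵇ 1) xor t ⌊ 2 * m /2⌋          ≡⟨ cong₂ (λ r h → (r ≡ᵇ 1) xor t h) remainder half ⟩
  t m                                           ∎
  where
  open ≡-Reasoning
  remainder : 2 * m % 2 ≡ 0
  remainder = trans (cong (_% 2) (*-comm 2 m)) (m*n%n≡0 m 2)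
  half : ⌊ 2 * m /2⌋ ≡ m
  half = trans (cong ⌊_/2⌋ (2*m≡m+m m)) (sym (n≡⌊n+n/2⌋ m))

t-suc-double : ∀ m → t (suc (2 * m)) ≡ not (t m)
t-suc-double m = begin
  t (suc (2 * m))                                     ≡⟨ t-unfold (suc (2 * m)) ⟩
  ((suc (2 * m) % 2) ≡ᵇ 1) xor t ⌊ suc (2 * m) /2⌋    ≡⟨ cong₂ (λ r h → (r ≡ᵇ 1) xor t h) remainder half ⟩
  true xor t m                                        ≡⟨⟩
  not (t m)                                           ∎
  where
  open ≡-Reasoning
  remainder : suc (2 * m) % 2 ≡ 1
  remainder = trans (cong (λ a → suc a % 2) (*-comm 2 m)) ([m+kn]%n≡m%n 1 m 2)
  half : ⌊ suc (2 * m) /2⌋ ≡ m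
  half = trans (cong (λ a → ⌊ suc a /2⌋) (2*m≡m+m m)) (⌊1+m+m/2⌋≡m m)

t-2^k* : ∀ k m → t (2 ^ k * m) ≡ t m
t-2^k* zero    m = cong t (+-identityʳ m)
t-2^k* (suc k) m = trans (cong t (*-assoc 2 (2 ^ k) m)) (trans (t-double (2 ^ k * m)) (t-2^k* k m))

even⊎odd : ∀ m → ∃[ j ] (m ≡ 2 * j ⊎ m ≡ suc (2 * j))
even⊎odd zero = 0 , inj₁ refl
even⊎odd (suc m) with even⊎odd m
... | j , inj₁ refl = j , inj₂ refl
... | j , inj₂ refl = suc j , inj₁ (cong suc (sym (+-suc j (j + 0))))

pred-double : ∀ {n M} → suc n ≡ 2 * M → ∃[ a ] n ≡ suc (2 * a) × suc a ≡ M
pred-double {M = zero}  ()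
pred-double {M = suc a} e = a , trans (suc-injective e) (+-suc a (a + 0)) , refl

Even-suc⇒¬Even : ∀ {n} → Even (suc n) → ¬ Even n
Even-suc⇒¬Even {n} 2∣1+n 2∣n with ∣1⇒≡1 (∣m+n∣m⇒∣n (subst (2 ∣_) (+-comm 1 n) 2∣1+n) 2∣n)
... | ()

¬Even-* : ∀ {m n} → ¬ Even m → ¬ Even n → ¬ Even (m * n)
¬Even-* {m} {n} ¬2∣m ¬2∣n 2∣mn = [ ¬2∣m , ¬2∣n ]′ (euclidsLemma m n 2-prime 2∣mn)
  where
  2-prime : Prime 2
  2-prime = from-yes (prime? 2)

IsNu2⇒odd-part : ∀ {m} k → IsNu2 m k → ∃[ j ] m ≡ 2 ^ k * suc (2 * j)
IsNu2⇒odd-part k (divides q m≡q*2^k , 2^1+k∤m) with even⊎odd q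
... | j , inj₁ refl = ⊥-elim (2^1+k∤m (divides j (trans m≡q*2^k 2j*p≡j*2p)))
  where
  2j*p≡j*2p : 2 * j * 2 ^ k ≡ j * 2 ^ suc k
  2j*p≡j*2p = trans (cong (_* 2 ^ k) (*-comm 2 j)) (*-assoc j 2 (2 ^ k))
... | j , inj₂ refl = j , trans m≡q*2^k (*-comm (suc (2 * j)) (2 ^ k))

t-odd-part : ∀ {m} k j → m ≡ 2 ^ k * suc (2 * j) → t m ≡ not (t j)
t-odd-part k j e = trans (cong t e) (trans (t-2^k* k (suc (2 * j))) (t-suc-double j))

-- n = 4 b + 3 with 1 + b = 4^c (2j+1): two odd steps give t n = ¬¬ t b.
t-pred-4^* : ∀ c j {n} → suc n ≡ 4 ^ c * suc (2 * j) → t n ≡ t j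
t-pred-4^* zero j e = trans (cong t (suc-injective (trans e (+-identityʳ (suc (2 * j)))))) (t-double j)
t-pred-4^* (suc c) j {n} e
  with a , n≡1+2a , 1+a≡2M ← pred-double (trans e (trans (*-assoc 4 (4 ^ c) (suc (2 * j)))
                                                          (*-assoc 2 2 (4 ^ c * suc (2 * j)))))
  with b , a≡1+2b , 1+b≡M  ← pred-double 1+a≡2M = begin
    t n                   ≡⟨ cong t n≡1+2a ⟩
    t (suc (2 * a))       ≡⟨ t-suc-double a ⟩
    not (t a)             ≡⟨ cong (not ∘ t) a≡1+2b ⟩
    not (t (suc (2 * b))) ≡⟨ cong not (t-suc-double b) ⟩
    not (not (t b))       ≡⟨ not-involutive (t b) ⟩
    t b                   ≡⟨ t-pred-4^* c j 1+b≡M ⟩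
    t j                   ∎
  where open ≡-Reasoning

2^[2c]≡4^c : ∀ c → 2 ^ (2 * c) ≡ 4 ^ c
2^[2c]≡4^c c = sym (^-*-assoc 2 2 c)

t-suc≡not-t-if-even-ν₂ : ∀ {n} c → IsNu2 (suc n) (2 * c) → t (suc n) ≡ not (t n)
t-suc≡not-t-if-even-ν₂ {n} c ν with j , 1+n≡ ← IsNu2⇒odd-part (2 * c) ν =
  trans (t-odd-part (2 * c) j 1+n≡)
        (cong not (sym (t-pred-4^* c j (trans 1+n≡ (cong (_* suc (2 * j)) (2^[2c]≡4^c c))))))

t-suc≡t-if-odd-ν₂ : ∀ {n} c → IsNu2 (suc n) (suc (2 * c)) → t (suc n) ≡ t n
t-suc≡t-if-odd-ν₂ {n} c ν
  with j , 1+n≡ ← IsNu2⇒odd-part (suc (2 * c)) ν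
  with a , n≡1+2a , 1+a≡M ← pred-double (trans 1+n≡ (*-assoc 2 (2 ^ (2 * c)) (suc (2 * j)))) = begin
    t (suc n)        ≡⟨ t-odd-part (suc (2 * c)) j 1+n≡ ⟩
    not (t j)        ≡⟨ cong not (t-pred-4^* c j (trans 1+a≡M (cong (_* suc (2 * j)) (2^[2c]≡4^c c)))) ⟨
    not (t a)        ≡⟨ t-suc-double a ⟨
    t (suc (2 * a))  ≡⟨ cong t n≡1+2a ⟨
    t n              ∎
  where open ≡-Reasoning

IsLeastAbove : ℕ → Bool → ℕ → Set
IsLeastAbove L b X = L < X × t X ≡ b × (∀ y → L < y → y < X → ¬ (t y ≡ b))

leastAbove-≤ : ∀ {L b X c} → IsLeastAbove L b X → L < c → t c ≡ b → X ≤ c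
leastAbove-≤ (_ , _ , least) L<c tc≡b = ≮⇒≥ (λ c<X → least _ L<c c<X tc≡b)

ClosedForm : ℕ → ℕ → Set
ClosedForm n X = (t (suc n) ≡ t n → X ≡ 2 * n + 2) × (¬ (t (suc n) ≡ t n) → X ≡ 2 * n + 3)

2n+2≡2[1+n] : ∀ n → 2 * n + 2 ≡ 2 * suc n
2n+2≡2[1+n] n = trans (+-comm (2 * n) 2) (sym (*-suc 2 n))

2n+3≡1+2[1+n] : ∀ n → 2 * n + 3 ≡ suc (2 * suc n)
2n+3≡1+2[1+n] n = trans (+-suc (2 * n) 2) (cong suc (2n+2≡2[1+n] n))

closedForm-bounds : ∀ {n X} → ClosedForm n X → 2 * suc n ≤ X × X ≤ suc (2 * suc n)
closedForm-bounds {n} (if-agree , if-differ) with t (suc n) ≟ᵇ t n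
... | yes agree  rewrite if-agree agree =
  ≤-reflexive (sym (2n+2≡2[1+n] n)) , ≤-trans (≤-reflexive (2n+2≡2[1+n] n)) (n≤1+n _)
... | no  differ rewrite if-differ differ =
  ≤-trans (n≤1+n _) (≤-reflexive (sym (2n+3≡1+2[1+n] n))) , ≤-reflexive (2n+3≡1+2[1+n] n)

closedForm-of-leastAbove : ∀ {n L X} → 2 * n ≤ L → L ≤ suc (2 * n) →
                           IsLeastAbove L (t n) X → ClosedForm n X
closedForm-of-leastAbove {n} {L} {X} 2n≤L L≤1+2n least@(L<X , tX≡tn , _) = decide (t (suc n) ≟ᵇ t n)
  where
  t[2n+2] : t (2 * n + 2) ≡ t (suc n)
  t[2n+2] = trans (cong t (2n+2≡2[1+n] n)) (t-double (suc n))

  t[2n+3] : t (2 * n + 3) ≡ not (t (suc n))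
  t[2n+3] = trans (cong t (2n+3≡1+2[1+n] n)) (t-suc-double (suc n))

  L<2n+2 : L < 2 * n + 2
  L<2n+2 = ≤-trans (s≤s L≤1+2n) (≤-reflexive (+-comm 2 (2 * n)))

  2n+2≤X : 2 * n + 2 ≤ X
  2n+2≤X = subst (_≤ X) (+-comm 2 (2 * n))
    (≤∧≢⇒< (≤-trans (s≤s 2n≤L) L<X) (λ e → not-¬ (trans (sym (t-suc-double n)) (trans (cong t e) tX≡tn)) refl))

  decide : Dec (t (suc n) ≡ t n) → ClosedForm n X
  decide (yes agree) =
    (λ _ → ≤-antisym (leastAbove-≤ least L<2n+2 (trans t[2n+2] agree)) 2n+2≤X) ,
    (λ differ → contradiction agree differ)
  decide (no differ) =
    (λ agree → contradiction agree differ) ,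
    (λ _ → ≤-antisym X≤2n+3 2n+3≤X)
    where
    L<2n+3 : L < 2 * n + 3
    L<2n+3 = ≤-trans L<2n+2 (≤-trans (n≤1+n _) (≤-reflexive (sym (+-suc (2 * n) 2))))
    X≤2n+3 : X ≤ 2 * n + 3
    X≤2n+3 = leastAbove-≤ least L<2n+3 (trans t[2n+3] (sym (¬-not (differ ∘ sym))))
    2n+3≤X : 2 * n + 3 ≤ X
    2n+3≤X = subst (_≤ X) (sym (+-suc (2 * n) 2))
      (≤∧≢⇒< 2n+2≤X (λ e → differ (trans (sym t[2n+2]) (trans (cong t e) tX≡tn))))

x-closedForm : ∀ {x} → IsX4 x → ∀ n → 1 ≤ n → ClosedForm n (x n)
x-closedForm (x1≡4 , _) 1 _ = (λ _ → x1≡4) , (λ t2≢t1 → contradiction refl t2≢t1)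
x-closedForm hx (suc (suc m)) _
  with 2[2+m]≤L , L≤1+2[2+m] ← closedForm-bounds {n = suc m} (x-closedForm hx (suc m) (s≤s z≤n)) =
  closedForm-of-leastAbove {n = 2 + m} 2[2+m]≤L L≤1+2[2+m] (proj₂ hx (2 + m) (s≤s (s≤s z≤n)))

closedForm-ν₂ : ∀ {n k X} → IsNu2 (suc n) k → ClosedForm n X →
                (Even (n * k) → X ≡ 2 * n + 3) × (¬ Even (n * k) → X ≡ 2 * n + 2)
closedForm-ν₂ {n} {k} ν (if-agree , if-differ) with even⊎odd k
... | c , inj₁ refl =
  (λ _ → if-differ (λ agree → not-¬ agree (t-suc≡not-t-if-even-ν₂ c ν))) ,
  (λ ¬2∣nk → contradiction (∣n⇒∣m*n n (m∣m*n c)) ¬2∣nk)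
... | c , inj₂ refl =
  (λ 2∣nk → ⊥-elim (¬Even-* ¬2∣n ¬2∣k 2∣nk)) ,
  (λ _ → if-agree (t-suc≡t-if-odd-ν₂ c ν))
  where
  ¬2∣n : ¬ Even n
  ¬2∣n = Even-suc⇒¬Even (∣-trans (m∣m*n (2 ^ (2 * c))) (proj₁ ν))
  ¬2∣k : ¬ Even (suc (2 * c))
  ¬2∣k 2∣k = Even-suc⇒¬Even 2∣k (m∣m*n c)

lemma4 : (x : ℕ → ℕ) → IsX4 x → (n k : ℕ) → 1 ≤ n → IsNu2 (n + 1) k →
         (Even (n * k) → x n ≡ 2 * n + 3) × (¬ Even (n * k) → x n ≡ 2 * n + 2)
lemma4 x hx n k 1≤n ν =
  closedForm-ν₂ {n} {k} (subst (λ m → IsNu2 m k) (+-comm n 1) ν) (x-closedForm hx n 1≤n)
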